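{- Let $G$ be a finite group acting $2$-transitively on $\Omega$, and let $\psi\in\mathrm{Irr}(G)$ be such that $1+\psi$ is the permutation character of this action. Let $L$ be a $(G,\Omega)$-Cameron-Liebler set with parameter $x$, and let $X\subseteq L$ and $Y\subseteq G\setminus L$ with $|X|=|Y|$. Then $\bar L=(L\setminus X)\cup Y$ is a Cameron-Liebler set of parameter $x$ if and only if $$\psi(Xg^{ -1})-\psi(Yg^{ -1})=(\delta_X(g)-\delta_Y(g))\frac{|G|}{\psi(1)}\quad\text{for all } g\in G.$$
   Context: For $S\subseteq G$, $\psi(S)=\sum_{s\in S}\psi(s)$ and $Sg^{ -1}=\{sg^{ -1}:s\in S\}$; $\delta_S(g)=1$ if $g\in S$ and $0$ otherwise. The permutation character is $g\mapsto$ number of fixed points of $g$. For $a,b\in\Omega$ the star is $G_{a\to b}=\{g:g(a)=b\}$ with indicator vector $\mathbf{v}_{a,b}$. A $(G,\Omega)$-Cameron-Liebler set is a subset of $G$ whose indicator vector is a linear combination of the $\mathbf{v}_{a,b}$; its parameter is $|L|\,|\Omega|/|G|$. -}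

module Defs where

open import Data.Nat as ℕ using (ℕ; zero; suc)
open import Data.Integer as ℤ using (ℤ; +_; +[1+_]; -[1+_])
open import Data.Rational using (ℚ; mkℚ; 0ℚ; 1ℚ; _+_; _*_; _-_; _÷_; _/_; _<_)
open import Data.Fin using (Fin; zero; suc)
open import Data.Bool using (Bool; true; false; if_then_else_; _∧_; _∨_; not)
open import Data.Product using (Σ; _×_; ∃)
open import Relation.Binary.PropositionalEquality using (_≡_; _≢_)
open import Relation.Nullary using (does)
open import Data.Fin using (_≟_)
open import Algebra.Structures using (IsGroup)

Σℚ : (m : ℕ) → (Fin m → ℚ) → ℚ
Σℚ zero    f = 0ℚ
Σℚ (suc m) f = f zero + Σℚ m (λ i → f (suc i))

ℕ→ℚ : ℕ → ℚ
ℕ→ℚ k = (+ k) / 1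

𝟙 : Bool → ℚ
𝟙 b = if b then 1ℚ else 0ℚ

-- Total division on ℚ (p ÷ 0 := 0); only used with a nonzero denominator.
_÷₀_ : ℚ → ℚ → ℚ
p ÷₀ mkℚ (+ zero)   _ _ = 0ℚ
p ÷₀ q@(mkℚ +[1+ _ ] _ _) = p ÷ q
p ÷₀ q@(mkℚ -[1+ _ ] _ _) = p ÷ q

record FiniteGroup : Set where
  field
    N       : ℕ
    _∙_     : Fin N → Fin N → Fin N
    ε       : Fin N
    _⁻¹     : Fin N → Fin N
    isGroup : IsGroup _≡_ _∙_ ε _⁻¹

Subset : ℕ → Set
Subset m = Fin m → Bool

∣_∣ : {m : ℕ} → Subset m → ℚ
∣_∣ {m} S = Σℚ m (λ i → 𝟙 (S i))

module _ (G : FiniteGroup) where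
  open FiniteGroup G

  record Action (n : ℕ) : Set where
    field
      act     : Fin N → Fin n → Fin n
      act-ε   : ∀ a → act ε a ≡ a
      act-∙   : ∀ g h a → act (g ∙ h) a ≡ act g (act h a)

  module _ {n : ℕ} (A : Action n) where
    open Action A

    TwoTransitive : Set
    TwoTransitive = ∀ a b c d → a ≢ b → c ≢ d →
      ∃ λ g → act g a ≡ c × act g b ≡ d

    permChar : Fin N → ℚ
    permChar g = Σℚ n (λ a → 𝟙 (does (act g a ≟ a)))

    ψ : Fin N → ℚ
    ψ g = permChar g - 1ℚ

    ψ[_] : Subset N → ℚ
    ψ[ S ] = Σℚ N (λ s → 𝟙 (S s) * ψ s)

    ψ[_·_⁻¹] : Subset N → Fin N → ℚ
    ψ[ S · g ⁻¹] = Σℚ N (λ s → 𝟙 (S s) * ψ (s ∙ (g ⁻¹)))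

    -- Irreducibility of the (integer-valued, generalized) character ψ:
    -- ⟨ψ,ψ⟩ = 1 and ψ(1) > 0.
    IsIrreducibleψ : Set
    IsIrreducibleψ =
      (Σℚ N (λ g → ψ g * ψ g) ≡ ℕ→ℚ N) × (0ℚ < ψ ε)

    v : Fin n → Fin n → Fin N → ℚ
    v a b g = 𝟙 (does (act g a ≟ b))

    IsCameronLiebler : Subset N → Set
    IsCameronLiebler L = Σ (Fin n → Fin n → ℚ) λ c →
      ∀ g → 𝟙 (L g) ≡ Σℚ n (λ a → Σℚ n (λ b → c a b * v a b g))

    parameter : Subset N → ℚ
    parameter L = (∣ L ∣ * ℕ→ℚ n) ÷₀ ℕ→ℚ N

    IsCameronLieblerWithParam : Subset N → ℚ → Set
    IsCameronLieblerWithParam L x = IsCameronLiebler L × x ≡ parameter L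

{-# OPTIONS --safe #-}
-- Write Δ = δ_X − δ_Y, so that δ_L̄ = δ_L − Δ: since L is Cameron–Liebler, so is L̄ exactly when
-- Δ lies in the span of the star vectors v_{a,b}, and |X| = |Y| makes the parameters agree.
-- Right convolution with ψ, (Δ ⋆ ψ)(g) = Σ_s Δ(s) ψ(s g⁻¹), maps every function into that span,
-- because 1 + ψ(s g⁻¹) = #{a : s a = g a} = Σ_{a,b} v_{a,b}(s) v_{a,b}(g); so Δ ⋆ ψ = K Δ with
-- K ≠ 0 puts Δ in the span. Conversely, 2-transitivity makes |G_{a→b} ∩ G_{a′→b′}| a constant β
-- whenever a ≠ a′ and b ≠ b′, which gives v_{a,b} ⋆ ψ = nβ v_{a,b} − β with nβ = |G|/ψ(1). A
-- combination Σ c_{a,b} v_{a,b} sums over G to (n−1)β Σ c_{a,b}, so when it sums to 0 (as Δ does)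
-- the constant terms cancel and it is an eigenvector of ⋆ψ for the eigenvalue |G|/ψ(1).
module Submission where

open import Defs
open import Data.Nat using (ℕ; zero; suc)
import Data.Integer as ℤ
import Data.Integer.Properties as ℤ
open import Data.Rational using (ℚ; mkℚ; 0ℚ; 1ℚ; NonZero; _+_; _*_; _-_; _/_; _÷_; 1/_; _<_; *<*; ≢-nonZero)
import Data.Rational.Properties as ℚ
open import Data.Rational.Solver using (module +-*-Solver)
import Data.Nat.Coprimality as Coprimality
open import Data.Fin using (Fin; zero; suc; _≟_)
open import Data.Fin.Permutation using (permutation)
open import Data.Bool using (true; false; _∧_; _∨_; not)
open import Data.Product using (Σ; _,_; proj₁; proj₂)
open import Data.Empty using (⊥-elim)
open import Function using (_∘_; id)
open import Relation.Nullary using (does; yes; no; contradiction)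
open import Relation.Binary.PropositionalEquality
open import Function.Bundles using (_⇔_; mk⇔; Equivalence)
open import Level using (0ℓ)
open import Algebra.Bundles using (Group)
open import Algebra.Structures using (IsGroup)
import Algebra.Properties.Group as GroupProperties
import Algebra.Properties.CommutativeMonoid.Sum as CommutativeMonoidSum

open +-*-Solver

ℕ→ℚ-canonical : ∀ k → ℕ→ℚ k ≡ mkℚ (ℤ.+ k) 0 (Coprimality.sym (Coprimality.1-coprimeTo k))
ℕ→ℚ-canonical k = ℚ.normalize-coprime _

ℕ→ℚ-suc : ∀ k → ℕ→ℚ (suc k) ≡ 1ℚ + ℕ→ℚ k
ℕ→ℚ-suc k = begin
  (ℤ.+ suc k) / 1
    -- the next right-hand side unfolds to (+ 1 ℤ.+ + k ℤ.* + 1) / 1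
    ≡⟨ cong (λ i → (ℤ.+ 1 ℤ.+ i) / 1) (sym (ℤ.*-identityʳ (ℤ.+ k))) ⟩
  1ℚ + mkℚ (ℤ.+ k) 0 (Coprimality.sym (Coprimality.1-coprimeTo k))
    ≡⟨ cong (λ q → 1ℚ + q) (sym (ℕ→ℚ-canonical k)) ⟩
  1ℚ + ℕ→ℚ k ∎
  where open ≡-Reasoning

ℕ→ℚ-suc≢0 : ∀ k → ℕ→ℚ (suc k) ≢ 0ℚ
ℕ→ℚ-suc≢0 k eq with trans (sym (ℕ→ℚ-canonical (suc k))) eq
... | ()

*-÷-cancelʳ : ∀ p q .{{_ : NonZero q}} → (p * q) ÷ q ≡ p
*-÷-cancelʳ p q = begin
  (p * q) * 1/ q  ≡⟨ ℚ.*-assoc p q (1/ q) ⟩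
  p * (q * 1/ q)  ≡⟨ cong (p *_) (ℚ.*-inverseʳ q) ⟩
  p * 1ℚ          ≡⟨ ℚ.*-identityʳ p ⟩
  p               ∎
  where open ≡-Reasoning

*-÷₀-cancelʳ : ∀ p q → q ≢ 0ℚ → (p * q) ÷₀ q ≡ p
*-÷₀-cancelʳ p q@(mkℚ (ℤ.+ zero) _ _) q≢0 = ⊥-elim (q≢0 (ℚ.↥p≡0⇒p≡0 q refl))
*-÷₀-cancelʳ p q@(mkℚ ℤ.+[1+ _ ] _ _) _   = *-÷-cancelʳ p q
*-÷₀-cancelʳ p q@(mkℚ ℤ.-[1+ _ ] _ _) _   = *-÷-cancelʳ p q

*-cancelˡ-≢0 : ∀ q {p r} → q ≢ 0ℚ → q * p ≡ q * r → p ≡ r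
*-cancelˡ-≢0 q {p} {r} q≢0 eq = begin
  p            ≡⟨ *-÷₀-cancelʳ p q q≢0 ⟨
  (p * q) ÷₀ q ≡⟨ cong (_÷₀ q) (trans (ℚ.*-comm p q) (trans eq (ℚ.*-comm q r))) ⟩
  (r * q) ÷₀ q ≡⟨ *-÷₀-cancelʳ r q q≢0 ⟩
  r            ∎
  where open ≡-Reasoning

ℕ→ℚ-≢0 : ∀ {m} → Fin m → ℕ→ℚ m ≢ 0ℚ
ℕ→ℚ-≢0 {suc k} _ = ℕ→ℚ-suc≢0 k

Σ-cong : ∀ {m} {f g : Fin m → ℚ} → (∀ i → f i ≡ g i) → Σℚ m f ≡ Σℚ m g
Σ-cong {zero}  eq = refl
Σ-cong {suc m} eq = cong₂ _+_ (eq zero) (Σ-cong (eq ∘ suc))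

Σ-zero : ∀ m → Σℚ m (λ _ → 0ℚ) ≡ 0ℚ
Σ-zero zero    = refl
Σ-zero (suc m) = trans (ℚ.+-identityˡ _) (Σ-zero m)

Σ-+ : ∀ {m} (f g : Fin m → ℚ) → Σℚ m (λ i → f i + g i) ≡ Σℚ m f + Σℚ m g
Σ-+ {zero}  f g = refl
Σ-+ {suc m} f g = trans (cong (f zero + g zero +_) (Σ-+ (f ∘ suc) (g ∘ suc)))
  (solve 4 (λ a b c d → (a :+ b) :+ (c :+ d) := (a :+ c) :+ (b :+ d)) refl (f zero) (g zero) _ _)

Σ-- : ∀ {m} (f g : Fin m → ℚ) → Σℚ m (λ i → f i - g i) ≡ Σℚ m f - Σℚ m g
Σ-- {zero}  f g = refl
Σ-- {suc m} f g = trans (cong (f zero - g zero +_) (Σ-- (f ∘ suc) (g ∘ suc)))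
  (solve 4 (λ a b c d → (a :- b) :+ (c :- d) := (a :+ c) :- (b :+ d)) refl (f zero) (g zero) _ _)

Σ-*ʳ : ∀ {m} k (f : Fin m → ℚ) → Σℚ m (λ i → f i * k) ≡ Σℚ m f * k
Σ-*ʳ {zero}  k f = sym (ℚ.*-zeroˡ k)
Σ-*ʳ {suc m} k f = trans (cong (f zero * k +_) (Σ-*ʳ k (f ∘ suc))) (sym (ℚ.*-distribʳ-+ k (f zero) _))

Σ-*ˡ : ∀ {m} k (f : Fin m → ℚ) → Σℚ m (λ i → k * f i) ≡ k * Σℚ m f
Σ-*ˡ {zero}  k f = sym (ℚ.*-zeroʳ k)
Σ-*ˡ {suc m} k f = trans (cong (k * f zero +_) (Σ-*ˡ k (f ∘ suc))) (sym (ℚ.*-distribˡ-+ k (f zero) _))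

Σ-const : ∀ m k → Σℚ m (λ _ → k) ≡ ℕ→ℚ m * k
Σ-const zero    k = sym (ℚ.*-zeroˡ k)
Σ-const (suc m) k = begin
  k + Σℚ m (λ _ → k)    ≡⟨ cong (k +_) (Σ-const m k) ⟩
  k + ℕ→ℚ m * k         ≡⟨ solve 2 (λ k x → k :+ x :* k := (con 1ℚ :+ x) :* k) refl k (ℕ→ℚ m) ⟩
  (1ℚ + ℕ→ℚ m) * k      ≡⟨ cong (_* k) (sym (ℕ→ℚ-suc m)) ⟩
  ℕ→ℚ (suc m) * k       ∎
  where open ≡-Reasoning

Σ-const-1 : ∀ m → Σℚ m (λ _ → 1ℚ) ≡ ℕ→ℚ m
Σ-const-1 m = trans (Σ-const m 1ℚ) (ℚ.*-identityʳ (ℕ→ℚ m))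

Σ-swap : ∀ {m n} (f : Fin m → Fin n → ℚ) →
  Σℚ m (λ i → Σℚ n (f i)) ≡ Σℚ n (λ j → Σℚ m (λ i → f i j))
Σ-swap {zero}  {n} f = sym (Σ-zero n)
Σ-swap {suc m} {n} f = trans (cong (Σℚ n (f zero) +_) (Σ-swap (f ∘ suc)))
  (sym (Σ-+ (f zero) (λ j → Σℚ m (λ i → f (suc i) j))))

Σℚ² : ∀ m → (Fin m → Fin m → ℚ) → ℚ
Σℚ² m f = Σℚ m (λ i → Σℚ m (f i))

Σℚ²-cong : ∀ {m} {f g : Fin m → Fin m → ℚ} → (∀ i j → f i j ≡ g i j) → Σℚ² m f ≡ Σℚ² m g
Σℚ²-cong eq = Σ-cong (λ i → Σ-cong (eq i))

Σℚ²-- : ∀ {m} (f g : Fin m → Fin m → ℚ) → Σℚ² m (λ i j → f i j - g i j) ≡ Σℚ² m f - Σℚ² m g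
Σℚ²-- {m} f g = trans (Σ-cong (λ i → Σ-- (f i) (g i))) (Σ-- (λ i → Σℚ m (f i)) (λ i → Σℚ m (g i)))

Σℚ²-*ˡ : ∀ {m} k (f : Fin m → Fin m → ℚ) → Σℚ² m (λ i j → k * f i j) ≡ k * Σℚ² m f
Σℚ²-*ˡ {m} k f = trans (Σ-cong (λ i → Σ-*ˡ k (f i))) (Σ-*ˡ k (λ i → Σℚ m (f i)))

Σ-Σℚ²-swap : ∀ {k m} (f : Fin k → Fin m → Fin m → ℚ) →
  Σℚ k (λ s → Σℚ² m (f s)) ≡ Σℚ² m (λ i j → Σℚ k (λ s → f s i j))
Σ-Σℚ²-swap f = trans (Σ-swap (λ s i → Σℚ _ (f s i))) (Σ-cong (λ i → Σ-swap (λ s → f s i)))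

module ℚ-Σ = CommutativeMonoidSum ℚ.+-0-commutativeMonoid

Σℚ≡sum : ∀ {m} (f : Fin m → ℚ) → Σℚ m f ≡ ℚ-Σ.sum f
Σℚ≡sum {zero}  f = refl
Σℚ≡sum {suc m} f = cong (f zero +_) (Σℚ≡sum (f ∘ suc))

Σ-bijection : ∀ {m} (σ τ : Fin m → Fin m) → (∀ i → σ (τ i) ≡ i) → (∀ i → τ (σ i) ≡ i) →
  (f : Fin m → ℚ) → Σℚ m (f ∘ σ) ≡ Σℚ m f
Σ-bijection σ τ στ τσ f = begin
  Σℚ _ (f ∘ σ)     ≡⟨ Σℚ≡sum (f ∘ σ) ⟩
  ℚ-Σ.sum (f ∘ σ)  ≡⟨ ℚ-Σ.∑-permute f (permutation σ τ στ τσ) ⟨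
  ℚ-Σ.sum f        ≡⟨ Σℚ≡sum f ⟨
  Σℚ _ f           ∎
  where open ≡-Reasoning

δ : ∀ {m} → Fin m → Fin m → ℚ
δ x y = 𝟙 (does (x ≟ y))

module _ {m : ℕ} where

  δ-≡ : ∀ {x y : Fin m} → x ≡ y → δ x y ≡ 1ℚ
  δ-≡ {x} {y} x≡y with x ≟ y
  ... | yes _   = refl
  ... | no  x≢y = ⊥-elim (x≢y x≡y)

  δ-≢ : ∀ {x y : Fin m} → x ≢ y → δ x y ≡ 0ℚ
  δ-≢ {x} {y} x≢y with x ≟ y
  ... | yes x≡y = ⊥-elim (x≢y x≡y)
  ... | no  _   = refl

  δ-cong-⇔ : ∀ {x y x′ y′ : Fin m} → (x ≡ y → x′ ≡ y′) → (x′ ≡ y′ → x ≡ y) → δ x y ≡ δ x′ y′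
  δ-cong-⇔ {x} {y} to from with x ≟ y
  ... | yes x≡y = sym (δ-≡ (to x≡y))
  ... | no  x≢y = sym (δ-≢ (x≢y ∘ from))

  δ-sym : ∀ (x y : Fin m) → δ x y ≡ δ y x
  δ-sym x y = δ-cong-⇔ {x} {y} {y} {x} sym sym

  δ-*-same-source : ∀ (x y z : Fin m) → δ x y * δ x z ≡ δ y z * δ x y
  δ-*-same-source x y z with x ≟ y
  ... | yes refl = ℚ.*-comm 1ℚ (δ x z)
  ... | no  _    = trans (ℚ.*-zeroˡ (δ x z)) (sym (ℚ.*-zeroʳ (δ y z)))

  δ-*-disjoint : ∀ {x y : Fin m} z → x ≢ y → δ x z * δ y z ≡ 0ℚ
  δ-*-disjoint {x} {y} z x≢y with x ≟ z
  ... | yes refl = trans (ℚ.*-identityˡ _) (δ-≢ (x≢y ∘ sym))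
  ... | no  _    = ℚ.*-zeroˡ (δ y z)

Σ-δ : ∀ {m} (x : Fin m) (f : Fin m → ℚ) → Σℚ m (λ y → δ x y * f y) ≡ f x
Σ-δ {suc m} zero f = begin
  1ℚ * f zero + Σℚ m (λ y → 0ℚ * f (suc y))  ≡⟨ cong (1ℚ * f zero +_) (Σ-cong (λ y → ℚ.*-zeroˡ (f (suc y)))) ⟩
  1ℚ * f zero + Σℚ m (λ _ → 0ℚ)              ≡⟨ cong (1ℚ * f zero +_) (Σ-zero m) ⟩
  1ℚ * f zero + 0ℚ                           ≡⟨ solve 1 (λ a → con 1ℚ :* a :+ con 0ℚ := a) refl (f zero) ⟩
  f zero                                     ∎
  where open ≡-Reasoning
Σ-δ {suc m} (suc x) f = begin
  0ℚ * f zero + Σℚ m (λ y → δ x y * f (suc y))  ≡⟨ cong (0ℚ * f zero +_) (Σ-δ x (f ∘ suc)) ⟩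
  0ℚ * f zero + f (suc x)                       ≡⟨ solve 2 (λ a b → con 0ℚ :* a :+ b := b) refl (f zero) (f (suc x)) ⟩
  f (suc x)                                     ∎
  where open ≡-Reasoning

Σ-δ-1 : ∀ {m} (x : Fin m) → Σℚ m (δ x) ≡ 1ℚ
Σ-δ-1 x = trans (Σ-cong (λ y → sym (ℚ.*-identityʳ (δ x y)))) (Σ-δ x (λ _ → 1ℚ))

Σ-δᶜ : ∀ {m} (x : Fin m) k → Σℚ m (λ y → (1ℚ - δ x y) * k) ≡ (ℕ→ℚ m - 1ℚ) * k
Σ-δᶜ {m} x k = begin
  Σℚ m (λ y → (1ℚ - δ x y) * k)       ≡⟨ Σ-*ʳ k (λ y → 1ℚ - δ x y) ⟩
  Σℚ m (λ y → 1ℚ - δ x y) * k         ≡⟨ cong (_* k) (Σ-- (λ _ → 1ℚ) (δ x)) ⟩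
  (Σℚ m (λ _ → 1ℚ) - Σℚ m (δ x)) * k  ≡⟨ cong₂ (λ a b → (a - b) * k) (Σ-const-1 m) (Σ-δ-1 x) ⟩
  (ℕ→ℚ m - 1ℚ) * k                    ∎
  where open ≡-Reasoning

Σ-split : ∀ {m} (x : Fin m) (X Y : Fin m → ℚ) →
  Σℚ m (λ i → δ x i * X i + (1ℚ - δ x i) * Y i) ≡ X x + (Σℚ m Y - Y x)
Σ-split {m} x X Y = begin
  Σℚ m (λ i → δ x i * X i + (1ℚ - δ x i) * Y i)
    ≡⟨ Σ-cong (λ i → solve 3 (λ d a b → d :* a :+ (con 1ℚ :- d) :* b := (d :* a :+ b) :- d :* b)
                       refl (δ x i) (X i) (Y i)) ⟩
  Σℚ m (λ i → (δ x i * X i + Y i) - δ x i * Y i)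
    ≡⟨ Σ-- (λ i → δ x i * X i + Y i) (λ i → δ x i * Y i) ⟩
  Σℚ m (λ i → δ x i * X i + Y i) - Σℚ m (λ i → δ x i * Y i)
    ≡⟨ cong₂ _-_ (Σ-+ (λ i → δ x i * X i) Y) (Σ-δ x Y) ⟩
  (Σℚ m (λ i → δ x i * X i) + Σℚ m Y) - Y x
    ≡⟨ cong (λ s → (s + Σℚ m Y) - Y x) (Σ-δ x X) ⟩
  (X x + Σℚ m Y) - Y x
    ≡⟨ ℚ.+-assoc (X x) (Σℚ m Y) _ ⟩
  X x + (Σℚ m Y - Y x) ∎
  where open ≡-Reasoning

≡-⇔ : ∀ {a} {B : Set a} {x x′ y y′ : B} → x ≡ x′ → y ≡ y′ → (x ≡ y) ⇔ (x′ ≡ y′)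
≡-⇔ refl refl = mk⇔ id id

𝟙-switch : ∀ l x y → (x ≡ true → l ≡ true) → (y ≡ true → l ≡ false) →
  𝟙 ((l ∧ not x) ∨ y) ≡ 𝟙 l - (𝟙 x - 𝟙 y)
𝟙-switch true  true  true  _   y⇒¬l = contradiction (y⇒¬l refl) λ ()
𝟙-switch true  true  false _   _    = refl
𝟙-switch true  false true  _   y⇒¬l = contradiction (y⇒¬l refl) λ ()
𝟙-switch true  false false _   _    = refl
𝟙-switch false true  _     x⇒l _    = contradiction (x⇒l refl) λ ()
𝟙-switch false false true  _   _    = refl
𝟙-switch false false false _   _    = refl

two-distinct-points : ∀ n → 0ℚ < ℕ→ℚ n - 1ℚ → Σ (Fin n) λ a → Σ (Fin n) λ b → a ≢ b
two-distinct-points 0             (*<* ())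
two-distinct-points 1             (*<* (ℤ.+<+ ()))
two-distinct-points (suc (suc _)) _ = zero , suc zero , λ ()

module ActionProperties (G : FiniteGroup) {n : ℕ} (A : Action G n) where
  open FiniteGroup G
  open Action A
  open IsGroup isGroup using (inverseˡ; inverseʳ)

  group : Group 0ℓ 0ℓ
  group = record { isGroup = isGroup }

  open GroupProperties group
    using (\\-leftDividesˡ; \\-leftDividesʳ; //-rightDividesˡ; //-rightDividesʳ)

  act-inverseˡ : ∀ g a → act (g ⁻¹) (act g a) ≡ a
  act-inverseˡ g a = begin
    act (g ⁻¹) (act g a)  ≡⟨ act-∙ (g ⁻¹) g a ⟨
    act ((g ⁻¹) ∙ g) a    ≡⟨ cong (λ h → act h a) (inverseˡ g) ⟩
    act ε a               ≡⟨ act-ε a ⟩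
    a                     ∎
    where open ≡-Reasoning

  act-inverseʳ : ∀ g a → act g (act (g ⁻¹) a) ≡ a
  act-inverseʳ g a = begin
    act g (act (g ⁻¹) a)  ≡⟨ act-∙ g (g ⁻¹) a ⟨
    act (g ∙ (g ⁻¹)) a    ≡⟨ cong (λ h → act h a) (inverseʳ g) ⟩
    act ε a               ≡⟨ act-ε a ⟩
    a                     ∎
    where open ≡-Reasoning

  act-injective : ∀ g {a b} → act g a ≡ act g b → a ≡ b
  act-injective g {a} {b} eq =
    trans (sym (act-inverseˡ g a)) (trans (cong (act (g ⁻¹)) eq) (act-inverseˡ g b))

  δ-act : ∀ g a b → δ (act g a) (act g b) ≡ δ a b
  δ-act g a b = δ-cong-⇔ (act-injective g) (cong (act g))

  Σ-act : ∀ g (f : Fin n → ℚ) → Σℚ n (λ a → f (act g a)) ≡ Σℚ n f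
  Σ-act g = Σ-bijection (act g) (act (g ⁻¹)) (act-inverseʳ g) (act-inverseˡ g)

  Σ-translateˡ : ∀ h (f : Fin N → ℚ) → Σℚ N (λ s → f (h ∙ s)) ≡ Σℚ N f
  Σ-translateˡ h = Σ-bijection (h ∙_) ((h ⁻¹) ∙_) (\\-leftDividesˡ h) (\\-leftDividesʳ h)

  Σ-translateʳ : ∀ k (f : Fin N → ℚ) → Σℚ N (λ s → f (s ∙ k)) ≡ Σℚ N f
  Σ-translateʳ k = Σ-bijection (_∙ k) (_∙ (k ⁻¹)) (//-rightDividesˡ k) (//-rightDividesʳ k)

  starSize : Fin n → Fin n → ℚ
  starSize a b = Σℚ N (v G A a b)

  starMeetSize : Fin n → Fin n → Fin n → Fin n → ℚ
  starMeetSize a b a′ b′ = Σℚ N (λ s → v G A a b s * v G A a′ b′ s)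

  starMeet-same-source : ∀ a b b′ → starMeetSize a b a b′ ≡ δ b b′ * starSize a b
  starMeet-same-source a b b′ =
    trans (Σ-cong (λ s → δ-*-same-source (act s a) b b′)) (Σ-*ˡ (δ b b′) (v G A a b))

  starMeet-collide : ∀ {a a′} b → a ≢ a′ → starMeetSize a b a′ b ≡ 0ℚ
  starMeet-collide b a≢a′ = trans (Σ-cong (λ s → δ-*-disjoint b (a≢a′ ∘ act-injective s))) (Σ-zero N)

  starCombination : (Fin n → Fin n → ℚ) → Fin N → ℚ
  starCombination c g = Σℚ² n (λ a b → c a b * v G A a b g)

  InStarSpan : (Fin N → ℚ) → Set
  InStarSpan f = Σ (Fin n → Fin n → ℚ) λ c → ∀ g → f g ≡ starCombination c g

  starCombination-- : ∀ c c′ g →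
    starCombination c g - starCombination c′ g ≡ starCombination (λ a b → c a b - c′ a b) g
  starCombination-- c c′ g = sym (trans
    (Σℚ²-cong (λ a b → solve 3 (λ x y w → (x :- y) :* w := x :* w :- y :* w) refl (c a b) (c′ a b) (v G A a b g)))
    (Σℚ²-- (λ a b → c a b * v G A a b g) (λ a b → c′ a b * v G A a b g)))

  starCombination-*ˡ : ∀ k c g → k * starCombination c g ≡ starCombination (λ a b → k * c a b) g
  starCombination-*ˡ k c g = sym (trans
    (Σℚ²-cong (λ a b → ℚ.*-assoc k (c a b) (v G A a b g)))
    (Σℚ²-*ˡ k (λ a b → c a b * v G A a b g)))

  InStarSpan-cong : ∀ {f f′} → (∀ g → f g ≡ f′ g) → InStarSpan f → InStarSpan f′
  InStarSpan-cong f≡f′ (c , f≡c) = c , λ g → trans (sym (f≡f′ g)) (f≡c g)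

  InStarSpan-- : ∀ {f f′} → InStarSpan f → InStarSpan f′ → InStarSpan (λ g → f g - f′ g)
  InStarSpan-- (c , f≡c) (c′ , f′≡c′) =
    (λ a b → c a b - c′ a b) , λ g → trans (cong₂ _-_ (f≡c g) (f′≡c′ g)) (starCombination-- c c′ g)

  InStarSpan-*ˡ : ∀ k {f} → InStarSpan f → InStarSpan (λ g → k * f g)
  InStarSpan-*ˡ k (c , f≡c) = (λ a b → k * c a b) , λ g → trans (cong (k *_) (f≡c g)) (starCombination-*ˡ k c g)

  Σ-*-starCombination : ∀ (F : Fin N → ℚ) (C : Fin N → Fin n → Fin n → ℚ) g →
    Σℚ N (λ s → F s * starCombination (C s) g)
      ≡ starCombination (λ a b → Σℚ N (λ s → F s * C s a b)) g
  Σ-*-starCombination F C g = begin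
    Σℚ N (λ s → F s * starCombination (C s) g)
      ≡⟨ Σ-cong (λ s → Σℚ²-*ˡ (F s) (λ a b → C s a b * v G A a b g)) ⟨
    Σℚ N (λ s → Σℚ² n (λ a b → F s * (C s a b * v G A a b g)))
      ≡⟨ Σ-Σℚ²-swap (λ s a b → F s * (C s a b * v G A a b g)) ⟩
    Σℚ² n (λ a b → Σℚ N (λ s → F s * (C s a b * v G A a b g)))
      ≡⟨ Σℚ²-cong (λ a b → trans (Σ-cong (λ s → sym (ℚ.*-assoc (F s) (C s a b) (v G A a b g))))
                                 (Σ-*ʳ (v G A a b g) (λ s → F s * C s a b))) ⟩
    starCombination (λ a b → Σℚ N (λ s → F s * C s a b)) g ∎
    where open ≡-Reasoning

  Σ-starCombination-* : ∀ c (H : Fin N → ℚ) →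
    Σℚ N (λ s → starCombination c s * H s) ≡ Σℚ² n (λ a b → c a b * Σℚ N (λ s → v G A a b s * H s))
  Σ-starCombination-* c H = begin
    Σℚ N (λ s → starCombination c s * H s)
      ≡⟨ Σ-cong (λ s → trans (ℚ.*-comm (starCombination c s) (H s))
                             (sym (Σℚ²-*ˡ (H s) (λ a b → c a b * v G A a b s)))) ⟩
    Σℚ N (λ s → Σℚ² n (λ a b → H s * (c a b * v G A a b s)))
      ≡⟨ Σ-Σℚ²-swap (λ s a b → H s * (c a b * v G A a b s)) ⟩
    Σℚ² n (λ a b → Σℚ N (λ s → H s * (c a b * v G A a b s)))
      ≡⟨ Σℚ²-cong (λ a b → trans (Σ-cong (λ s → solve 3 (λ h x w → h :* (x :* w) := x :* (w :* h))
                                                         refl (H s) (c a b) (v G A a b s)))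
                                 (Σ-*ˡ (c a b) (λ s → v G A a b s * H s))) ⟩
    Σℚ² n (λ a b → c a b * Σℚ N (λ s → v G A a b s * H s)) ∎
    where open ≡-Reasoning

  Σ-starCombination : ∀ c → Σℚ N (starCombination c) ≡ Σℚ² n (λ a b → c a b * starSize a b)
  Σ-starCombination c = trans (Σ-Σℚ²-swap (λ s a b → c a b * v G A a b s))
                              (Σℚ²-cong (λ a b → Σ-*ˡ (c a b) (v G A a b)))

  Σ-starMeet : ∀ a b a′ → Σℚ n (starMeetSize a b a′) ≡ starSize a b
  Σ-starMeet a b a′ = begin
    Σℚ n (λ b′ → Σℚ N (λ s → v G A a b s * v G A a′ b′ s))
      ≡⟨ Σ-swap (λ s b′ → v G A a b s * v G A a′ b′ s) ⟨
    Σℚ N (λ s → Σℚ n (λ b′ → v G A a b s * v G A a′ b′ s))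
      ≡⟨ Σ-cong (λ s → Σ-*ˡ (v G A a b s) (δ (act s a′))) ⟩
    Σℚ N (λ s → v G A a b s * Σℚ n (δ (act s a′)))
      ≡⟨ Σ-cong (λ s → cong (v G A a b s *_) (Σ-δ-1 (act s a′))) ⟩
    Σℚ N (λ s → v G A a b s * 1ℚ)
      ≡⟨ Σ-cong (λ s → ℚ.*-identityʳ (v G A a b s)) ⟩
    starSize a b ∎
    where open ≡-Reasoning

  ψ-conv : (Fin N → ℚ) → Fin N → ℚ
  ψ-conv f g = Σℚ N (λ s → f s * ψ G A (s ∙ (g ⁻¹)))

  ψ-conv-permChar : ∀ f g → ψ-conv f g ≡ Σℚ N (λ s → f s * permChar G A (s ∙ (g ⁻¹))) - Σℚ N f
  ψ-conv-permChar f g = trans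
    (Σ-cong (λ s → solve 2 (λ x p → x :* (p :- con 1ℚ) := x :* p :- x) refl (f s) (permChar G A (s ∙ (g ⁻¹)))))
    (Σ-- (λ s → f s * permChar G A (s ∙ (g ⁻¹))) f)

  ψ-ε : ψ G A ε ≡ ℕ→ℚ n - 1ℚ
  ψ-ε = cong (_- 1ℚ) (trans (Σ-cong (λ a → δ-≡ (act-ε a))) (Σ-const-1 n))

  permChar-∙⁻¹ : ∀ s g → permChar G A (s ∙ (g ⁻¹)) ≡ Σℚ n (λ a → δ (act s a) (act g a))
  permChar-∙⁻¹ s g = begin
    Σℚ n (λ c → δ (act (s ∙ (g ⁻¹)) c) c)                   ≡⟨ Σ-act g (λ c → δ (act (s ∙ (g ⁻¹)) c) c) ⟨
    Σℚ n (λ a → δ (act (s ∙ (g ⁻¹)) (act g a)) (act g a))   ≡⟨ Σ-cong (λ a → cong (λ c → δ c (act g a)) (moves a)) ⟩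
    Σℚ n (λ a → δ (act s a) (act g a))                      ∎
    where
    open ≡-Reasoning
    moves : ∀ a → act (s ∙ (g ⁻¹)) (act g a) ≡ act s a
    moves a = trans (act-∙ s (g ⁻¹) (act g a)) (cong (act s) (act-inverseˡ g a))

  Σ-star-permChar : ∀ a b g →
    Σℚ N (λ s → v G A a b s * permChar G A (s ∙ (g ⁻¹))) ≡ Σℚ n (λ a′ → starMeetSize a b a′ (act g a′))
  Σ-star-permChar a b g = begin
    Σℚ N (λ s → v G A a b s * permChar G A (s ∙ (g ⁻¹)))
      ≡⟨ Σ-cong (λ s → cong (v G A a b s *_) (permChar-∙⁻¹ s g)) ⟩
    Σℚ N (λ s → v G A a b s * Σℚ n (λ a′ → δ (act s a′) (act g a′)))
      ≡⟨ Σ-cong (λ s → Σ-*ˡ (v G A a b s) (λ a′ → δ (act s a′) (act g a′))) ⟨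
    Σℚ N (λ s → Σℚ n (λ a′ → v G A a b s * v G A a′ (act g a′) s))
      ≡⟨ Σ-swap (λ s a′ → v G A a b s * v G A a′ (act g a′) s) ⟩
    Σℚ n (λ a′ → starMeetSize a b a′ (act g a′)) ∎
    where open ≡-Reasoning

  one-starCombination : ∀ a₀ g → 1ℚ ≡ starCombination (λ a _ → δ a₀ a) g
  one-starCombination a₀ g = sym (begin
    Σℚ² n (λ a b → δ a₀ a * v G A a b g)   ≡⟨ Σ-cong (λ a → Σ-*ˡ (δ a₀ a) (δ (act g a))) ⟩
    Σℚ n (λ a → δ a₀ a * Σℚ n (δ (act g a))) ≡⟨ Σ-cong (λ a → cong (δ a₀ a *_) (Σ-δ-1 (act g a))) ⟩
    Σℚ n (λ a → δ a₀ a * 1ℚ)               ≡⟨ Σ-δ a₀ (λ _ → 1ℚ) ⟩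
    1ℚ                                     ∎)
    where open ≡-Reasoning

  permChar-∙⁻¹-starCombination : ∀ s g → permChar G A (s ∙ (g ⁻¹)) ≡ starCombination (λ a b → δ (act s a) b) g
  permChar-∙⁻¹-starCombination s g = trans (permChar-∙⁻¹ s g)
    (Σ-cong (λ a → trans (δ-sym (act s a) (act g a)) (sym (Σ-δ (act s a) (δ (act g a))))))

  ψ-∙⁻¹-starCombination : ∀ a₀ s g →
    ψ G A (s ∙ (g ⁻¹)) ≡ starCombination (λ a b → δ (act s a) b - δ a₀ a) g
  ψ-∙⁻¹-starCombination a₀ s g =
    trans (cong₂ _-_ (permChar-∙⁻¹-starCombination s g) (one-starCombination a₀ g))
          (starCombination-- (λ a b → δ (act s a) b) (λ a _ → δ a₀ a) g)

  ψ-conv-inStarSpan : Fin n → ∀ f → InStarSpan (ψ-conv f)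
  ψ-conv-inStarSpan a₀ f = (λ a b → Σℚ N (λ s → f s * (δ (act s a) b - δ a₀ a))) , λ g →
    trans (Σ-cong (λ s → cong (f s *_) (ψ-∙⁻¹-starCombination a₀ s g)))
          (Σ-*-starCombination f (λ s a b → δ (act s a) b - δ a₀ a) g)

  eigen⇒inStarSpan : Fin n → ∀ {k f} → k ≢ 0ℚ → (∀ g → ψ-conv f g ≡ k * f g) → InStarSpan f
  eigen⇒inStarSpan a₀ {k} {f} k≢0 eigen =
    InStarSpan-cong f≡ (InStarSpan-*ˡ (1/ k) (ψ-conv-inStarSpan a₀ f))
    where
    instance _ = ≢-nonZero k≢0
    f≡ : ∀ g → 1/ k * ψ-conv f g ≡ f g
    f≡ g = begin
      1/ k * ψ-conv f g    ≡⟨ cong (1/ k *_) (eigen g) ⟩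
      1/ k * (k * f g)     ≡⟨ ℚ.*-assoc (1/ k) k (f g) ⟨
      (1/ k * k) * f g     ≡⟨ cong (_* f g) (ℚ.*-inverseˡ k) ⟩
      1ℚ * f g             ≡⟨ ℚ.*-identityˡ (f g) ⟩
      f g                  ∎
      where open ≡-Reasoning

  module TwoTransitiveCounting (2-transitive : TwoTransitive G A) {a₀ a₁ : Fin n} (a₀≢a₁ : a₀ ≢ a₁) where

    β : ℚ
    β = starMeetSize a₀ a₀ a₁ a₁

    α : ℚ
    α = (ℕ→ℚ n - 1ℚ) * β

    starMeet-distinct : ∀ {a b a′ b′} → a ≢ a′ → b ≢ b′ → starMeetSize a b a′ b′ ≡ β
    starMeet-distinct {a} {b} {a′} {b′} a≢a′ b≢b′
      with 2-transitive a₀ a₁ a a′ a₀≢a₁ a≢a′ | 2-transitive b b′ a₀ a₁ b≢b′ a₀≢a₁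
    ... | k , ka₀≡a , ka₁≡a′ | h , hb≡a₀ , hb′≡a₁ = begin
      starMeetSize a b a′ b′
        ≡⟨ Σ-cong (λ s → cong₂ _*_ (conjugate s ka₀≡a hb≡a₀) (conjugate s ka₁≡a′ hb′≡a₁)) ⟨
      Σℚ N (λ s → fixes (h ∙ (s ∙ k)))  ≡⟨ Σ-translateʳ k (λ t → fixes (h ∙ t)) ⟩
      Σℚ N (λ s → fixes (h ∙ s))        ≡⟨ Σ-translateˡ h fixes ⟩
      β                                 ∎
      where
      open ≡-Reasoning
      fixes : Fin N → ℚ
      fixes s = v G A a₀ a₀ s * v G A a₁ a₁ s
      conjugate : ∀ s {c d x y} → act k c ≡ x → act h y ≡ d → v G A c d (h ∙ (s ∙ k)) ≡ v G A x y s
      conjugate s {c} {d} {x} {y} kc≡x hy≡d = trans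
        (cong₂ δ (trans (act-∙ h (s ∙ k) c) (cong (act h) (trans (act-∙ s k c) (cong (act s) kc≡x))))
                 (sym hy≡d))
        (δ-act h (act s x) y)

    starMeet-formula : ∀ {a a′} b b′ → a ≢ a′ → starMeetSize a b a′ b′ ≡ (1ℚ - δ b b′) * β
    starMeet-formula b b′ a≢a′ with b ≟ b′
    ... | yes refl = trans (starMeet-collide b a≢a′) (sym (ℚ.*-zeroˡ β))
    ... | no b≢b′  = trans (starMeet-distinct a≢a′ b≢b′) (sym (ℚ.*-identityˡ β))

    starMeet-decomposition : ∀ a b a′ b′ → starMeetSize a b a′ b′
      ≡ δ a a′ * (δ b b′ * starSize a b) + (1ℚ - δ a a′) * ((1ℚ - δ b b′) * β)
    starMeet-decomposition a b a′ b′ with a ≟ a′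
    ... | yes refl = trans (starMeet-same-source a b b′)
                           (solve 2 (λ x y → x := con 1ℚ :* x :+ (con 1ℚ :- con 1ℚ) :* y) refl _ ((1ℚ - δ b b′) * β))
    ... | no a≢a′  = trans (starMeet-formula b b′ a≢a′)
                           (solve 2 (λ x y → y := con 0ℚ :* x :+ (con 1ℚ :- con 0ℚ) :* y) refl (δ b b′ * starSize a b) _)

    other-point : ∀ a → Σ (Fin n) (a ≢_)
    other-point a with a ≟ a₀
    ... | yes refl = a₁ , a₀≢a₁
    ... | no a≢a₀  = a₀ , a≢a₀

    starSize-formula : ∀ a b → starSize a b ≡ α
    starSize-formula a b = begin
      starSize a b                             ≡⟨ Σ-starMeet a b a′ ⟨
      Σℚ n (starMeetSize a b a′)               ≡⟨ Σ-cong (λ b′ → starMeet-formula b b′ a≢a′) ⟩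
      Σℚ n (λ b′ → (1ℚ - δ b b′) * β)          ≡⟨ Σ-δᶜ b β ⟩
      α                         ∎
      where
      open ≡-Reasoning
      a′ = proj₁ (other-point a)
      a≢a′ = proj₂ (other-point a)

    n*α≡nβ*[n-1] : ℕ→ℚ n * α ≡ ℕ→ℚ n * β * (ℕ→ℚ n - 1ℚ)
    n*α≡nβ*[n-1] = solve 2 (λ ν b → ν :* ((ν :- con 1ℚ) :* b) := ν :* b :* (ν :- con 1ℚ)) refl (ℕ→ℚ n) β

    order-formula : ℕ→ℚ N ≡ ℕ→ℚ n * β * (ℕ→ℚ n - 1ℚ)
    order-formula = begin
      ℕ→ℚ N                                  ≡⟨ Σ-const-1 N ⟨
      Σℚ N (λ _ → 1ℚ)                        ≡⟨ Σ-cong (λ s → Σ-δ-1 (act s a₀)) ⟨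
      Σℚ N (λ s → Σℚ n (λ b → v G A a₀ b s)) ≡⟨ Σ-swap (λ s b → v G A a₀ b s) ⟩
      Σℚ n (starSize a₀)                     ≡⟨ Σ-cong (starSize-formula a₀) ⟩
      Σℚ n (λ _ → α)                         ≡⟨ Σ-const n α ⟩
      ℕ→ℚ n * α                              ≡⟨ n*α≡nβ*[n-1] ⟩
      ℕ→ℚ n * β * (ℕ→ℚ n - 1ℚ)               ∎
      where open ≡-Reasoning

    α≢0 : α ≢ 0ℚ
    α≢0 eq = ℕ→ℚ-≢0 ε (begin
      ℕ→ℚ N                     ≡⟨ order-formula ⟩
      ℕ→ℚ n * β * (ℕ→ℚ n - 1ℚ)  ≡⟨ n*α≡nβ*[n-1] ⟨
      ℕ→ℚ n * α                 ≡⟨ cong (ℕ→ℚ n *_) eq ⟩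
      ℕ→ℚ n * 0ℚ                ≡⟨ ℚ.*-zeroʳ (ℕ→ℚ n) ⟩
      0ℚ                        ∎)
      where open ≡-Reasoning

    nβ≢0 : ℕ→ℚ n * β ≢ 0ℚ
    nβ≢0 eq = ℕ→ℚ-≢0 ε (trans order-formula (trans (cong (_* (ℕ→ℚ n - 1ℚ)) eq) (ℚ.*-zeroˡ (ℕ→ℚ n - 1ℚ))))

    eigenvalue : ℕ→ℚ N ÷₀ ψ G A ε ≡ ℕ→ℚ n * β
    eigenvalue = trans (cong₂ _÷₀_ order-formula ψ-ε) (*-÷₀-cancelʳ (ℕ→ℚ n * β) (ℕ→ℚ n - 1ℚ) n-1≢0)
      where
      n-1≢0 : ℕ→ℚ n - 1ℚ ≢ 0ℚ
      n-1≢0 eq = ℕ→ℚ-≢0 ε (trans order-formula (trans (cong (ℕ→ℚ n * β *_) eq) (ℚ.*-zeroʳ (ℕ→ℚ n * β))))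

    ψ-conv-star : ∀ a b g → ψ-conv (v G A a b) g ≡ ℕ→ℚ n * β * v G A a b g - β
    ψ-conv-star a b g = begin
      ψ-conv (v G A a b) g
        ≡⟨ ψ-conv-permChar (v G A a b) g ⟩
      Σℚ N (λ s → v G A a b s * permChar G A (s ∙ (g ⁻¹))) - starSize a b
        ≡⟨ cong₂ _-_ (Σ-star-permChar a b g) (starSize-formula a b) ⟩
      Σℚ n (λ a′ → starMeetSize a b a′ (act g a′)) - α
        ≡⟨ cong (_- α) (Σ-cong (λ a′ → starMeet-decomposition a b a′ (act g a′))) ⟩
      Σℚ n (λ a′ → δ a a′ * X a′ + (1ℚ - δ a a′) * Y a′) - α
        ≡⟨ cong (_- α) (Σ-split a X Y) ⟩
      (X a + (Σℚ n Y - Y a)) - α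
        ≡⟨ cong₂ (λ σ s → (δ b (act g a) * s + (σ - Y a)) - α) ΣY (starSize-formula a b) ⟩
      (δ b (act g a) * α + (α - (1ℚ - δ b (act g a)) * β)) - α
        ≡⟨ solve 3 (λ d ν b → (d :* ((ν :- con 1ℚ) :* b) :+ ((ν :- con 1ℚ) :* b :- (con 1ℚ :- d) :* b))
                                :- (ν :- con 1ℚ) :* b := ν :* b :* d :- b)
                   refl (δ b (act g a)) (ℕ→ℚ n) β ⟩
      ℕ→ℚ n * β * δ b (act g a) - β
        ≡⟨ cong (λ d → ℕ→ℚ n * β * d - β) (δ-sym b (act g a)) ⟩
      ℕ→ℚ n * β * v G A a b g - β ∎
      where
      open ≡-Reasoning
      X Y : Fin n → ℚ
      X a′ = δ b (act g a′) * starSize a b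
      Y a′ = (1ℚ - δ b (act g a′)) * β
      ΣY : Σℚ n Y ≡ α
      ΣY = trans (Σ-act g (λ c → (1ℚ - δ b c) * β)) (Σ-δᶜ b β)

    ψ-conv-starCombination : ∀ c g →
      ψ-conv (starCombination c) g ≡ ℕ→ℚ n * β * starCombination c g - β * Σℚ² n c
    ψ-conv-starCombination c g = begin
      ψ-conv (starCombination c) g
        ≡⟨ Σ-starCombination-* c (λ s → ψ G A (s ∙ (g ⁻¹))) ⟩
      Σℚ² n (λ a b → c a b * ψ-conv (v G A a b) g)
        ≡⟨ Σℚ²-cong (λ a b → cong (c a b *_) (ψ-conv-star a b g)) ⟩
      Σℚ² n (λ a b → c a b * (K * v G A a b g - β))
        ≡⟨ Σℚ²-cong (λ a b → solve 4 (λ x k w b → x :* (k :* w :- b) := k :* (x :* w) :- b :* x)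
                                     refl (c a b) K (v G A a b g) β) ⟩
      Σℚ² n (λ a b → K * (c a b * v G A a b g) - β * c a b)
        ≡⟨ Σℚ²-- (λ a b → K * (c a b * v G A a b g)) (λ a b → β * c a b) ⟩
      Σℚ² n (λ a b → K * (c a b * v G A a b g)) - Σℚ² n (λ a b → β * c a b)
        ≡⟨ cong₂ _-_ (Σℚ²-*ˡ K (λ a b → c a b * v G A a b g)) (Σℚ²-*ˡ β c) ⟩
      K * starCombination c g - β * Σℚ² n c ∎
      where
      open ≡-Reasoning
      K : ℚ
      K = ℕ→ℚ n * β

    Σ-starCombination-formula : ∀ c → Σℚ N (starCombination c) ≡ α * Σℚ² n c
    Σ-starCombination-formula c = trans (Σ-starCombination c) (trans
      (Σℚ²-cong (λ a b → trans (cong (c a b *_) (starSize-formula a b)) (ℚ.*-comm (c a b) _)))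
      (Σℚ²-*ˡ α c))

    inStarSpan⇒eigen : ∀ {f} → Σℚ N f ≡ 0ℚ → InStarSpan f → ∀ g → ψ-conv f g ≡ ℕ→ℚ n * β * f g
    inStarSpan⇒eigen {f} Σf≡0 (c , f≡c) g = begin
      ψ-conv f g
        ≡⟨ Σ-cong (λ s → cong (_* ψ G A (s ∙ (g ⁻¹))) (f≡c s)) ⟩
      ψ-conv (starCombination c) g
        ≡⟨ ψ-conv-starCombination c g ⟩
      ℕ→ℚ n * β * starCombination c g - β * Σℚ² n c
        ≡⟨ cong₂ (λ x y → ℕ→ℚ n * β * x - β * y) (sym (f≡c g)) Σc≡0 ⟩
      ℕ→ℚ n * β * f g - β * 0ℚ
        ≡⟨ solve 2 (λ x b → x :- b :* con 0ℚ := x) refl (ℕ→ℚ n * β * f g) β ⟩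
      ℕ→ℚ n * β * f g ∎
      where
      open ≡-Reasoning
      Σc≡0 : Σℚ² n c ≡ 0ℚ
      Σc≡0 = *-cancelˡ-≢0 α α≢0 (begin
        α * Σℚ² n c               ≡⟨ Σ-starCombination-formula c ⟨
        Σℚ N (starCombination c)  ≡⟨ Σ-cong f≡c ⟨
        Σℚ N f                    ≡⟨ Σf≡0 ⟩
        0ℚ                        ≡⟨ ℚ.*-zeroʳ α ⟨
        α * 0ℚ                    ∎)

  module Switching (L X Y : Subset N)
    (X⊆L : ∀ g → X g ≡ true → L g ≡ true) (Y∩L≡∅ : ∀ g → Y g ≡ true → L g ≡ false) where

    L̄ : Subset N
    L̄ g = (L g ∧ not (X g)) ∨ Y g

    Δ : Fin N → ℚ
    Δ g = 𝟙 (X g) - 𝟙 (Y g)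

    𝟙-L̄ : ∀ g → 𝟙 (L̄ g) ≡ 𝟙 (L g) - Δ g
    𝟙-L̄ g = 𝟙-switch (L g) (X g) (Y g) (X⊆L g) (Y∩L≡∅ g)

    ΣΔ≡0 : ∣ X ∣ ≡ ∣ Y ∣ → Σℚ N Δ ≡ 0ℚ
    ΣΔ≡0 ∣X∣≡∣Y∣ = trans (Σ-- (𝟙 ∘ X) (𝟙 ∘ Y)) (trans (cong (_- ∣ Y ∣) ∣X∣≡∣Y∣) (ℚ.+-inverseʳ ∣ Y ∣))

    parameter-L̄ : ∣ X ∣ ≡ ∣ Y ∣ → parameter G A L̄ ≡ parameter G A L
    parameter-L̄ ∣X∣≡∣Y∣ = cong (λ size → (size * ℕ→ℚ n) ÷₀ ℕ→ℚ N) (begin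
      ∣ L̄ ∣                        ≡⟨ Σ-cong 𝟙-L̄ ⟩
      Σℚ N (λ g → 𝟙 (L g) - Δ g)   ≡⟨ Σ-- (𝟙 ∘ L) Δ ⟩
      ∣ L ∣ - Σℚ N Δ               ≡⟨ cong (∣ L ∣ -_) (ΣΔ≡0 ∣X∣≡∣Y∣) ⟩
      ∣ L ∣ - 0ℚ                   ≡⟨ solve 1 (λ l → l :- con 0ℚ := l) refl ∣ L ∣ ⟩
      ∣ L ∣                        ∎)
      where open ≡-Reasoning

    ψ[·⁻¹]-Δ : ∀ g → ψ[_·_⁻¹] G A X g - ψ[_·_⁻¹] G A Y g ≡ ψ-conv Δ g
    ψ[·⁻¹]-Δ g = sym (trans
      (Σ-cong (λ s → solve 3 (λ x y p → (x :- y) :* p := x :* p :- y :* p) refl (𝟙 (X s)) (𝟙 (Y s)) (ψ G A (s ∙ (g ⁻¹)))))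
      (Σ-- (λ s → 𝟙 (X s) * ψ G A (s ∙ (g ⁻¹))) (λ s → 𝟙 (Y s) * ψ G A (s ∙ (g ⁻¹)))))

    cameronLiebler-L̄⇔ : IsCameronLiebler G A L → IsCameronLiebler G A L̄ ⇔ InStarSpan Δ
    cameronLiebler-L̄⇔ L-CL = mk⇔
      (λ L̄-CL → InStarSpan-cong Δ≡ (InStarSpan-- L-CL L̄-CL))
      (λ Δ-span → InStarSpan-cong (sym ∘ 𝟙-L̄) (InStarSpan-- L-CL Δ-span))
      where
      Δ≡ : ∀ g → 𝟙 (L g) - 𝟙 (L̄ g) ≡ Δ g
      Δ≡ g = trans (cong (𝟙 (L g) -_) (𝟙-L̄ g)) (solve 2 (λ l d → l :- (l :- d) := d) refl (𝟙 (L g)) (Δ g))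

theorem4p5 : (G : FiniteGroup) {n : ℕ} (A : Action G n) →
    TwoTransitive G A →
    IsIrreducibleψ G A →
    (L : Subset (FiniteGroup.N G)) (x : ℚ) →
    IsCameronLieblerWithParam G A L x →
    (X Y : Subset (FiniteGroup.N G)) →
    (∀ g → X g ≡ true → L g ≡ true) →
    (∀ g → Y g ≡ true → L g ≡ false) →
    ∣ X ∣ ≡ ∣ Y ∣ →
    IsCameronLieblerWithParam G A (λ g → (L g ∧ not (X g)) ∨ Y g) x
      ⇔ (∀ g → ψ[_·_⁻¹] G A X g - ψ[_·_⁻¹] G A Y g
                 ≡ (𝟙 (X g) - 𝟙 (Y g)) * (ℕ→ℚ (FiniteGroup.N G) ÷₀ ψ G A (FiniteGroup.ε G)))
-- Of the irreducibility of ψ only ψ(1) > 0, i.e. |Ω| ≥ 2, is needed.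
theorem4p5 G {n} A 2-transitive (_ , 0<ψ1) L x (L-CL , x≡param) X Y X⊆L Y∩L≡∅ ∣X∣≡∣Y∣
  with two-distinct-points n (subst (0ℚ <_) (ActionProperties.ψ-ε G A) 0<ψ1)
... | a₀ , _ , a₀≢a₁ = mk⇔
  (λ (L̄-CL , _) g → from (eigen-equation g)
     (inStarSpan⇒eigen (ΣΔ≡0 ∣X∣≡∣Y∣) (to (cameronLiebler-L̄⇔ L-CL) L̄-CL) g))
  (λ eigen → from (cameronLiebler-L̄⇔ L-CL) (eigen⇒inStarSpan a₀ nβ≢0 (λ g → to (eigen-equation g) (eigen g)))
           , trans x≡param (sym (parameter-L̄ ∣X∣≡∣Y∣)))
  where
  open FiniteGroup G using (N; ε)
  open Equivalence using (to; from)
  open ActionProperties G A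
  open Switching L X Y X⊆L Y∩L≡∅
  open TwoTransitiveCounting 2-transitive a₀≢a₁
  eigen-equation : ∀ g → (ψ[_·_⁻¹] G A X g - ψ[_·_⁻¹] G A Y g ≡ Δ g * (ℕ→ℚ N ÷₀ ψ G A ε))
                         ⇔ (ψ-conv Δ g ≡ ℕ→ℚ n * β * Δ g)
  eigen-equation g = ≡-⇔ (ψ[·⁻¹]-Δ g) (trans (cong (Δ g *_) eigenvalue) (ℚ.*-comm (Δ g) (ℕ→ℚ n * β)))
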